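{- Let $n$ be even and let $I$ be a subgraph of $C^{e}_{4,n}$ with $\ell$ edges and $c$ components. Then \[|V(I)|-c\ge\frac{2}{3}\ell-1.\]
   Context: For even $n\ge 6$, $C^{e}_{4,n}$ is the graph on vertices $v_1,\dots,v_n$ with edges $v_{2i-1}v_{2i}$ ($i\in\{1,\dots,n/2\}$), the cycle $v_1v_3\cdots v_{n-1}v_1$ on the odd-indexed vertices and the cycle $v_2v_4\cdots v_nv_2$ on the even-indexed vertices; it is $3$-regular with $3n/2$ edges. A subgraph $I$ is identified with its edge set; $V(I)$ is the set of vertices incident to edges of $I$, and $c$ counts the connected components of $I$ (each containing at least one edge). -}

module Defs where

open import Data.Bool using (Bool; true; false; _∧_; _∨_; if_then_else_)
open import Data.Nat using (ℕ; zero; suc; _+_; _*_; _/_; _<ᵇ_; NonZero)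
open import Data.Nat.DivMod using (_mod_)
open import Data.Fin using (Fin; toℕ)
open import Data.Fin.Properties using () renaming (_≟_ to _≟ᶠ_)
open import Data.List using (List; []; _∷_; concatMap; upTo; allFin; length)
open import Data.Bool.ListAction using (any; all)
open import Data.Product using (_×_; _,_)
open import Relation.Nullary.Decidable using (⌊_⌋)

-- Vertices of C^e_{4,n} are Fin n; the paper's vertex v_{k+1} is (k mod n) here
-- (0-based indexing).  An edge is an (ordered representative) pair of vertices.
Edge : ℕ → Set
Edge n = Fin n × Fin n

vtx : (n : ℕ) .{{_ : NonZero n}} → ℕ → Fin n
vtx n k = k mod n

-- Edge list of C^e_{4,n}: for i = 0 .. n/2 - 1 (paper's index i+1):
--   rung            v_{2i+1} v_{2i+2}   (0-based: 2i, 2i+1)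
--   odd cycle edge  v_{2i+1} v_{2i+3}   (0-based: 2i, 2i+2 mod n)
--   even cycle edge v_{2i+2} v_{2i+4}   (0-based: 2i+1, 2i+3 mod n)
CE : (n : ℕ) .{{_ : NonZero n}} → List (Edge n)
CE n = concatMap
  (λ i → (vtx n (2 * i) , vtx n (2 * i + 1))
       ∷ (vtx n (2 * i) , vtx n (2 * i + 2))
       ∷ (vtx n (2 * i + 1) , vtx n (2 * i + 3)) ∷ [])
  (upTo (n / 2))

_==_ : {n : ℕ} → Fin n → Fin n → Bool
u == v = ⌊ u ≟ᶠ v ⌋

countᵇ : {A : Set} → (A → Bool) → List A → ℕ
countᵇ p [] = 0
countᵇ p (x ∷ xs) = if p x then suc (countᵇ p xs) else countᵇ p xs

incident : {n : ℕ} → Fin n → Edge n → Bool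
incident v (a , b) = (a == v) ∨ (b == v)

inV : {n : ℕ} → List (Edge n) → Fin n → Bool
inV I v = any (incident v) I

numV : (n : ℕ) → List (Edge n) → ℕ
numV n I = countᵇ (inV I) (allFin n)

adj : {n : ℕ} → List (Edge n) → Fin n → Fin n → Bool
adj I u v = any (λ { (a , b) → ((a == u) ∧ (b == v)) ∨ ((a == v) ∧ (b == u)) }) I

reach : (n : ℕ) → List (Edge n) → ℕ → Fin n → Fin n → Bool
reach n I zero u v = u == v
reach n I (suc k) u v =
  reach n I k u v ∨ any (λ w → reach n I k u w ∧ adj I w v) (allFin n)

-- u and v are connected in I (a walk of length ≤ n suffices on n vertices)
connected : (n : ℕ) → List (Edge n) → Fin n → Fin n → Bool
connected n I = reach n I n

isRep : (n : ℕ) → List (Edge n) → Fin n → Bool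
isRep n I v = inV I v ∧ all (λ u → if toℕ u <ᵇ toℕ v then notB (connected n I v u) else true) (allFin n)
  where
  notB : Bool → Bool
  notB true = false
  notB false = true

-- c(I): number of connected components of I (each containing an edge)
numComp : (n : ℕ) → List (Edge n) → ℕ
numComp n I = countᵇ (isRep n I) (allFin n)

module Submission where

-- Write G = C^e_{4,n} and J for the edges of G outside I. Since G is 3-regular, counting the
-- endpoints in V(I) of all edges of G gives 3|V(I)|; the edges of I contribute 2ℓ of this.
-- Since G is 3-edge-connected, each of the c − 1 components of I not containing v_1 is cut off
-- from v_1 by at least 3 edges, all in J, and an edge of J separates a component from the rest
-- only through an endpoint lying in that component. So the edges of J contribute at least
-- 3(c − 1), and 2ℓ + 3(c − 1) ≤ 3|V(I)|. Nothing else about G is used: for a d-regular,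
-- k-edge-connected graph the same count gives 2ℓ + k(c − 1) ≤ d|V(I)|. The prism C^e_{4,n} is
-- 3-edge-connected because a vertex set meeting one of its two n/2-cycles in a proper subset is
-- crossed twice by that cycle, while a set that is a union of whole cycles is crossed by all
-- n/2 ≥ 3 rungs.

module CutCounting where

  open import Defs
  open import Data.Bool using (Bool; true; false; T; T?; _∧_; _∨_; _xor_)
  open import Data.Bool.Properties using (T-∧; T-∨; ∨-comm; xor-same; xor-comm)
    renaming (_≟_ to _≟ᵇ_)
  open import Data.Bool.ListAction using (any)
  open import Data.Empty using (⊥-elim)
  open import Data.Fin using (Fin; toℕ; zero; suc)
  open import Data.Fin.Properties using (toℕ-injective; toℕ-fromℕ<; toℕ<n)
    renaming (_≟_ to _≟ᶠ_; suc-injective to Fin-suc-injective)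
  open import Data.List using (List; []; _∷_; _++_; length; concatMap; applyUpTo; tabulate; allFin)
  open import Data.List.Membership.Propositional using (_∈_; lose; find)
  open import Data.List.Membership.Propositional.Properties using (∈-allFin; ∈-tabulate⁻)
  open import Data.List.Relation.Unary.Any using (Any; here; there)
    renaming (map to Any-map)
  open import Data.List.Relation.Unary.Any.Properties using (any⁺; any⁻)
  open import Data.List.Relation.Unary.All using () renaming (lookup to All-lookup)
  open import Data.List.Relation.Unary.All.Properties using (all⁺)
  open import Data.List.Properties using (length-tabulate)
  open import Relation.Nullary.Decidable using (toWitness; fromWitness)
  open import Data.List.Relation.Binary.Sublist.Propositional using (_⊆_; []; _∷ʳ_; _∷_)
  open import Data.Nat
    using (ℕ; zero; suc; _+_; _*_; _/_; _≤_; _<_; z≤n; s≤s; z<s; s<s; _≤′_; ≤′-refl; ≤′-step; _<ᵇ_)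
  open import Data.Nat.Properties
  open import Data.Nat.Divisibility using (_∣_)
  open import Data.Nat.DivMod using (m*[n/m]≡n; [m+n]%n≡m%n; m<n⇒m%n≡m)
  open import Data.Nat.Tactic.RingSolver using (solve-∀)
  open import Data.Product using (_×_; _,_; proj₁; proj₂; ∃-syntax)
  open import Data.Sum using (_⊎_; inj₁; inj₂)
  open import Function using (_∘_; id; case_of_)
  open import Function.Bundles using (Equivalence)
  open Equivalence using (to; from)
  open import Relation.Nullary using (¬_; yes; no)
  open import Relation.Binary.PropositionalEquality hiding (J)
  open import Relation.Binary.Definitions using (tri<; tri≈; tri>)
  open import Algebra.Properties.CommutativeSemigroup +-commutativeSemigroup
    using () renaming (interchange to +-interchange)

  private
    variable
      A : Set

  T-injective : ∀ {a b} → (T a → T b) → (T b → T a) → a ≡ b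
  T-injective {false} {false} _ _ = refl
  T-injective {false} {true} _ b⇒a = ⊥-elim (b⇒a _)
  T-injective {true} {false} a⇒b _ = ⊥-elim (a⇒b _)
  T-injective {true} {true} _ _ = refl

  𝟙 : Bool → ℕ
  𝟙 true = 1
  𝟙 false = 0

  𝟙≤1 : ∀ b → 𝟙 b ≤ 1
  𝟙≤1 true = ≤-refl
  𝟙≤1 false = z≤n

  𝟙-mono : ∀ {a b} → (T a → T b) → 𝟙 a ≤ 𝟙 b
  𝟙-mono {false} _ = z≤n
  𝟙-mono {true} {true} _ = ≤-refl
  𝟙-mono {true} {false} a⇒b = ⊥-elim (a⇒b _)

  𝟙-< : ∀ {a b} → ¬ T a → T b → 𝟙 a < 𝟙 b
  𝟙-< {false} {true} _ _ = ≤-refl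
  𝟙-< {true} ¬a _ = ⊥-elim (¬a _)

  𝟙-true : ∀ {b} → T b → 𝟙 b ≡ 1
  𝟙-true {true} _ = refl

  𝟙-false : ∀ {b} → ¬ T b → 𝟙 b ≡ 0
  𝟙-false {false} _ = refl
  𝟙-false {true} ¬b = ⊥-elim (¬b _)

  ∑ : (A → ℕ) → List A → ℕ
  ∑ f [] = 0
  ∑ f (x ∷ xs) = f x + ∑ f xs

  countᵇ≡∑𝟙 : ∀ (p : A → Bool) xs → countᵇ p xs ≡ ∑ (𝟙 ∘ p) xs
  countᵇ≡∑𝟙 p [] = refl
  countᵇ≡∑𝟙 p (x ∷ xs) with p x
  ... | true = cong suc (countᵇ≡∑𝟙 p xs)
  ... | false = countᵇ≡∑𝟙 p xs

  ∑-cong : ∀ {f g : A → ℕ} xs → (∀ x → x ∈ xs → f x ≡ g x) → ∑ f xs ≡ ∑ g xs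
  ∑-cong [] _ = refl
  ∑-cong (x ∷ xs) f≡g = cong₂ _+_ (f≡g x (here refl)) (∑-cong xs (λ y → f≡g y ∘ there))

  ∑-mono : ∀ {f g : A → ℕ} xs → (∀ x → x ∈ xs → f x ≤ g x) → ∑ f xs ≤ ∑ g xs
  ∑-mono [] _ = z≤n
  ∑-mono (x ∷ xs) f≤g = +-mono-≤ (f≤g x (here refl)) (∑-mono xs (λ y → f≤g y ∘ there))

  ∑-mono-< : ∀ {f g : A → ℕ} {xs} → (∀ x → f x ≤ g x) → Any (λ x → f x < g x) xs →
    ∑ f xs < ∑ g xs
  ∑-mono-< {xs = x ∷ xs} f≤g (here fx<gx) = +-mono-<-≤ fx<gx (∑-mono xs (λ y _ → f≤g y))
  ∑-mono-< {xs = x ∷ xs} f≤g (there any<) = +-mono-≤-< (f≤g x) (∑-mono-< f≤g any<)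

  ∑-member : ∀ (f : A → ℕ) {x xs} → x ∈ xs → f x ≤ ∑ f xs
  ∑-member f (here refl) = m≤m+n _ _
  ∑-member f {xs = y ∷ _} (there x∈xs) = ≤-trans (∑-member f x∈xs) (m≤n+m _ (f y))

  ∑-const : ∀ c (xs : List A) → ∑ (λ _ → c) xs ≡ c * length xs
  ∑-const c [] = sym (*-zeroʳ c)
  ∑-const c (x ∷ xs) = trans (cong (c +_) (∑-const c xs)) (sym (*-suc c (length xs)))

  ∑-++ : ∀ (f : A → ℕ) xs ys → ∑ f (xs ++ ys) ≡ ∑ f xs + ∑ f ys
  ∑-++ f [] ys = refl
  ∑-++ f (x ∷ xs) ys = trans (cong (f x +_) (∑-++ f xs ys)) (sym (+-assoc (f x) _ _))

  ∑-+ : ∀ (f g : A → ℕ) xs → ∑ (λ x → f x + g x) xs ≡ ∑ f xs + ∑ g xs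
  ∑-+ f g [] = refl
  ∑-+ f g (x ∷ xs) = trans (cong (f x + g x +_) (∑-+ f g xs)) (+-interchange (f x) (g x) _ _)

  ∑-*ˡ : ∀ c (f : A → ℕ) xs → ∑ (λ x → c * f x) xs ≡ c * ∑ f xs
  ∑-*ˡ c f [] = sym (*-zeroʳ c)
  ∑-*ˡ c f (x ∷ xs) = trans (cong (c * f x +_) (∑-*ˡ c f xs)) (sym (*-distribˡ-+ c (f x) _))

  ∑-≡0 : ∀ {f : A → ℕ} xs → (∀ x → x ∈ xs → f x ≡ 0) → ∑ f xs ≡ 0
  ∑-≡0 [] _ = refl
  ∑-≡0 (x ∷ xs) f≡0 = cong₂ _+_ (f≡0 x (here refl)) (∑-≡0 xs (λ y → f≡0 y ∘ there))

  ∑-comm : ∀ {B : Set} (t : A → B → ℕ) xs ys →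
    ∑ (λ x → ∑ (t x) ys) xs ≡ ∑ (λ y → ∑ (λ x → t x y) xs) ys
  ∑-comm t [] ys = sym (∑-≡0 ys λ _ _ → refl)
  ∑-comm t (x ∷ xs) ys =
    trans (cong (∑ (t x) ys +_) (∑-comm t xs ys)) (sym (∑-+ (t x) _ ys))

  ∑-𝟙-none : ∀ {p : A → Bool} xs → (∀ x → x ∈ xs → ¬ T (p x)) → ∑ (𝟙 ∘ p) xs ≡ 0
  ∑-𝟙-none xs none = ∑-≡0 xs λ x x∈xs → 𝟙-false (none x x∈xs)

  ∑-tabulate-atMostOne : ∀ {k} (p : A → Bool) (f : Fin k → A) →
    (∀ i j → T (p (f i)) → T (p (f j)) → i ≡ j) → ∑ (𝟙 ∘ p) (tabulate f) ≤ 1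
  ∑-tabulate-atMostOne {k = zero} p f _ = z≤n
  ∑-tabulate-atMostOne {k = suc k} p f unique with p (f zero) in pf₀
  ... | true = ≤-reflexive (cong suc rest≡0)
    where
    none : ∀ i → ¬ T (p (f (suc i)))
    none i pfi with unique zero (suc i) (subst T (sym pf₀) _) pfi
    ... | ()
    rest≡0 : ∑ (𝟙 ∘ p) (tabulate (f ∘ suc)) ≡ 0
    rest≡0 = ∑-𝟙-none (tabulate (f ∘ suc)) λ x x∈ →
      case ∈-tabulate⁻ x∈ of λ { (i , refl) → none i }
  ... | false = ∑-tabulate-atMostOne p (f ∘ suc) λ i j pi pj → Fin-suc-injective (unique (suc i) (suc j) pi pj)

  ∑-𝟙-allFin-atMostOne : ∀ {n b} (p : Fin n → Bool) → (∀ u v → T (p u) → T (p v) → u ≡ v) →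
    (∀ v → T (p v) → T b) → ∑ (𝟙 ∘ p) (allFin n) ≤ 𝟙 b
  ∑-𝟙-allFin-atMostOne {b = true} p unique _ = ∑-tabulate-atMostOne p id unique
  ∑-𝟙-allFin-atMostOne {n} {b = false} p _ p⇒⊥ =
    ≤-reflexive (∑-𝟙-none (allFin n) λ v _ → p⇒⊥ v)

  complement : {xs ys : List A} → xs ⊆ ys → List A
  complement [] = []
  complement (y ∷ʳ xs⊆ys) = y ∷ complement xs⊆ys
  complement (_ ∷ xs⊆ys) = complement xs⊆ys

  ∑-complement : ∀ (f : A → ℕ) {xs ys} (xs⊆ys : xs ⊆ ys) →
    ∑ f ys ≡ ∑ f xs + ∑ f (complement xs⊆ys)
  ∑-complement f [] = refl
  ∑-complement f {xs} (y ∷ʳ xs⊆ys) =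
    trans (cong (f y +_) (∑-complement f xs⊆ys)) (+-comm-assoc (f y) (∑ f xs) _)
    where
    +-comm-assoc : ∀ a b c → a + (b + c) ≡ b + (a + c)
    +-comm-assoc a b c = trans (sym (+-assoc a b c)) (trans (cong (_+ c) (+-comm a b)) (+-assoc b a c))
  ∑-complement f (refl ∷ xs⊆ys) =
    trans (cong (f _ +_) (∑-complement f xs⊆ys)) (sym (+-assoc (f _) _ _))

  ∑< : ℕ → (ℕ → ℕ) → ℕ
  ∑< zero f = 0
  ∑< (suc m) f = f 0 + ∑< m (f ∘ suc)

  ∑<-cong : ∀ m {f g} → (∀ i → i < m → f i ≡ g i) → ∑< m f ≡ ∑< m g
  ∑<-cong zero _ = refl
  ∑<-cong (suc m) f≡g = cong₂ _+_ (f≡g 0 z<s) (∑<-cong m λ i i<m → f≡g (suc i) (s<s i<m))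

  ∑<-+ : ∀ m f g → ∑< m (λ i → f i + g i) ≡ ∑< m f + ∑< m g
  ∑<-+ zero f g = refl
  ∑<-+ (suc m) f g = trans (cong (f 0 + g 0 +_) (∑<-+ m (f ∘ suc) (g ∘ suc))) (+-interchange (f 0) (g 0) _ _)

  ∑<-split : ∀ j k f → ∑< (j + k) f ≡ ∑< j f + ∑< k (λ i → f (j + i))
  ∑<-split zero k f = refl
  ∑<-split (suc j) k f = trans (cong (f 0 +_) (∑<-split j k (f ∘ suc))) (sym (+-assoc (f 0) _ _))

  ∑<-snoc : ∀ m f → ∑< (suc m) f ≡ ∑< m f + f m
  ∑<-snoc zero f = +-comm (f 0) 0
  ∑<-snoc (suc m) f = trans (cong (f 0 +_) (∑<-snoc m (f ∘ suc))) (sym (+-assoc (f 0) _ _))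

  ∑<-rotate : ∀ m f → f m ≡ f 0 → ∑< m (f ∘ suc) ≡ ∑< m f
  ∑<-rotate m f fm≡f0 = +-cancelˡ-≡ (f 0) _ _ (begin
    ∑< (suc m) f    ≡⟨ ∑<-snoc m f ⟩
    ∑< m f + f m    ≡⟨ cong (∑< m f +_) fm≡f0 ⟩
    ∑< m f + f 0    ≡⟨ +-comm (∑< m f) (f 0) ⟩
    f 0 + ∑< m f    ∎)
    where open ≡-Reasoning

  ∑<-pairs : ∀ m f → ∑< (2 * m) f ≡ ∑< m (λ i → f (2 * i) + f (2 * i + 1))
  ∑<-pairs zero f = refl
  ∑<-pairs (suc m) f = begin
    ∑< (2 * suc m) f                                          ≡⟨ cong (λ k → ∑< k f) (*-suc 2 m) ⟩
    f 0 + (f 1 + ∑< (2 * m) (λ i → f (2 + i)))               ≡⟨ sym (+-assoc (f 0) (f 1) _) ⟩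
    f 0 + f 1 + ∑< (2 * m) (λ i → f (2 + i))
      ≡⟨ cong (f 0 + f 1 +_) (∑<-pairs m (λ i → f (2 + i))) ⟩
    f 0 + f 1 + ∑< m (λ i → f (2 + 2 * i) + f (2 + (2 * i + 1)))
      ≡⟨ cong (f 0 + f 1 +_) (∑<-cong m λ i _ →
           cong₂ (λ j k → f j + f k) (sym (*-suc 2 i)) (sym (cong (_+ 1) (*-suc 2 i)))) ⟩
    ∑< (suc m) (λ i → f (2 * i) + f (2 * i + 1))             ∎
    where open ≡-Reasoning

  ∑<-term : ∀ m f {j} → j < m → f j ≤ ∑< m f
  ∑<-term (suc m) f {zero} _ = m≤m+n (f 0) _
  ∑<-term (suc m) f {suc j} (s<s j<m) = ≤-trans (∑<-term m (f ∘ suc) j<m) (m≤n+m _ (f 0))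

  ∑<-positive : ∀ m f → 0 < ∑< m f → ∃[ i ] (i < m × 0 < f i)
  ∑<-positive (suc m) f ∑>0 with f 0 in f₀
  ... | suc _ = 0 , z<s , subst (0 <_) (sym f₀) z<s
  ... | zero with ∑<-positive m (f ∘ suc) ∑>0
  ...   | i , i<m , fi>0 = suc i , s<s i<m , fi>0

  ∑-concatMap-applyUpTo : ∀ (w : A → ℕ) (blk : ℕ → List A) g m →
    ∑ w (concatMap blk (applyUpTo g m)) ≡ ∑< m (λ i → ∑ w (blk (g i)))
  ∑-concatMap-applyUpTo w blk g zero = refl
  ∑-concatMap-applyUpTo w blk g (suc m) =
    trans (∑-++ w (blk (g 0)) _) (cong (∑ w (blk (g 0)) +_) (∑-concatMap-applyUpTo w blk (g ∘ suc) m))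

  ∑-tabulate : ∀ {k} (q : A → ℕ) (f : Fin k → A) (F : ℕ → A) →
    (∀ i → f i ≡ F (toℕ i)) → ∑ q (tabulate f) ≡ ∑< k (q ∘ F)
  ∑-tabulate {k = zero} q f F _ = refl
  ∑-tabulate {k = suc k} q f F f≗F =
    cong₂ _+_ (cong q (f≗F zero)) (∑-tabulate q (f ∘ suc) (F ∘ suc) (f≗F ∘ suc))

  contained-or-escapes : ∀ (p q : A → Bool) xs →
    (∀ x → x ∈ xs → T (q x) → T (p x)) ⊎ Any (λ x → T (q x) × ¬ T (p x)) xs
  contained-or-escapes p q [] = inj₁ λ _ ()
  contained-or-escapes p q (x ∷ xs) with T? (q x) | T? (p x) | contained-or-escapes p q xs
  ... | yes qx | no ¬px | _ = inj₂ (here (qx , ¬px))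
  ... | _ | _ | inj₂ escapes = inj₂ (there escapes)
  ... | yes _ | yes px | inj₁ sub = inj₁ λ { _ (here refl) _ → px ; y (there y∈xs) → sub y y∈xs }
  ... | no ¬qx | _ | inj₁ sub =
    inj₁ λ { _ (here refl) qx → ⊥-elim (¬qx qx) ; y (there y∈xs) → sub y y∈xs }

  ∑-𝟙≤length : ∀ (p : A → Bool) xs → ∑ (𝟙 ∘ p) xs ≤ length xs
  ∑-𝟙≤length p xs =
    ≤-trans (∑-mono xs λ x _ → 𝟙≤1 (p x)) (≤-reflexive (trans (∑-const 1 xs) (*-identityˡ _)))

  -- An increasing chain of subsets of xs can grow strictly at most length xs times.
  chain-stabilises : ∀ xs (P : ℕ → A → Bool) → (∀ k x → T (P k x) → T (P (suc k) x)) →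
    ∃[ s ] (s ≤ length xs × ∀ x → x ∈ xs → T (P (suc s) x) → T (P s x))
  chain-stabilises xs P increasing with stable-before (suc (length xs))
    where
    size : ℕ → ℕ
    size k = ∑ (𝟙 ∘ P k) xs
    stable-before : ∀ k →
      (∃[ s ] (s < k × ∀ x → x ∈ xs → T (P (suc s) x) → T (P s x))) ⊎ k ≤ size k
    stable-before zero = inj₂ z≤n
    stable-before (suc k) with stable-before k
    ... | inj₁ (s , s<k , stable) = inj₁ (s , m<n⇒m<1+n s<k , stable)
    ... | inj₂ k≤size with contained-or-escapes (P k) (P (suc k)) xs
    ...   | inj₁ stable = inj₁ (k , n<1+n k , stable)
    ...   | inj₂ escapes = inj₂ (≤-trans (s≤s k≤size) (∑-mono-< (λ x → 𝟙-mono (increasing k x))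
                                    (Any-map (λ (q , ¬p) → 𝟙-< ¬p q) escapes)))
  ... | inj₁ (s , s≤L , stable) = s , ≤-pred s≤L , stable
  ... | inj₂ L<size = ⊥-elim (<⇒≱ L<size (∑-𝟙≤length (P (suc (length xs))) xs))

  any-intro : ∀ (p : A → Bool) {x xs} → x ∈ xs → T (p x) → T (any p xs)
  any-intro p x∈xs px = any⁺ p (lose x∈xs px)

  any-elim : ∀ (p : A → Bool) xs → T (any p xs) → ∃[ x ] (x ∈ xs × T (p x))
  any-elim p xs h = find (any⁻ p xs h)

  ==-refl : ∀ {n} (x : Fin n) → T (x == x)
  ==-refl x = fromWitness {a? = x ≟ᶠ x} refl

  ==⇒≡ : ∀ {n} {x y : Fin n} → T (x == y) → x ≡ y
  ==⇒≡ {x = x} {y} = toWitness {a? = x ≟ᶠ y}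

  module _ {n : ℕ} (I : List (Edge n)) where

    adj-sym : ∀ x y → adj I x y ≡ adj I y x
    adj-sym x y = go I
      where
      go : (J : List (Edge n)) → adj J x y ≡ adj J y x
      go [] = refl
      go ((a , b) ∷ J) = cong₂ _∨_ (∨-comm ((a == x) ∧ (b == y)) _) (go J)

    edge⇒adj : ∀ {x y} → (x , y) ∈ I → T (adj I x y)
    edge⇒adj {x} {y} xy∈I =
      any-intro _ xy∈I (T-∨ {(x == x) ∧ (y == y)} .from (inj₁ (T-∧ .from (==-refl x , ==-refl y))))

    edge⇒inV : ∀ {x y} → (x , y) ∈ I → T (inV I x) × T (inV I y)
    edge⇒inV {x} {y} xy∈I =
      any-intro (incident x) xy∈I (T-∨ {x == x} .from (inj₁ (==-refl x))) ,
      any-intro (incident y) xy∈I (T-∨ {x == y} .from (inj₂ (==-refl y)))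

    adj⇒inV : ∀ {w x} → T (adj I w x) → T (inV I x)
    adj⇒inV {w} {x} wx with any-elim _ I wx
    ... | (p , q) , pq∈I , pq~wx with T-∨ {(p == w) ∧ (q == x)} .to pq~wx
    ...   | inj₁ p=w∧q=x = any-intro (incident x) pq∈I
            (T-∨ {p == x} .from (inj₂ (proj₂ (T-∧ {p == w} .to p=w∧q=x))))
    ...   | inj₂ p=x∧q=w = any-intro (incident x) pq∈I
            (T-∨ {p == x} .from (inj₁ (proj₁ (T-∧ {p == x} .to p=x∧q=w))))

    private
      R : ℕ → Fin n → Fin n → Bool
      R = reach n I

    reach-suc : ∀ k {u v} → T (R k u v) → T (R (suc k) u v)
    reach-suc k {u} {v} r = T-∨ {R k u v} .from (inj₁ r)

    reach-step : ∀ k {u w v} → T (R k u w) → T (adj I w v) → T (R (suc k) u v)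
    reach-step k {u} {w} {v} r a =
      T-∨ {R k u v} .from (inj₂ (any-intro _ (∈-allFin w) (T-∧ .from (r , a))))

    reach-inversion : ∀ k {u v} → T (R (suc k) u v) →
      T (R k u v) ⊎ ∃[ w ] (T (R k u w) × T (adj I w v))
    reach-inversion k {u} {v} r with T-∨ {R k u v} .to r
    ... | inj₁ r′ = inj₁ r′
    ... | inj₂ r′ with any-elim _ (allFin n) r′
    ...   | w , _ , rw∧a = inj₂ (w , T-∧ {R k u w} .to rw∧a)

    reach-mono : ∀ {k j u v} → k ≤′ j → T (R k u v) → T (R j u v)
    reach-mono ≤′-refl r = r
    reach-mono {j = suc j} (≤′-step k≤j) r = reach-suc j (reach-mono k≤j r)

    Saturated : Fin n → ℕ → Set
    Saturated u s = ∀ x → T (R (suc s) u x) → T (R s u x)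

    saturated-collapse : ∀ {u s j x} → Saturated u s → s ≤′ j → T (R j u x) → T (R s u x)
    saturated-collapse saturated ≤′-refl r = r
    saturated-collapse {s = s} {suc j} {x} saturated (≤′-step s≤j) r with reach-inversion j r
    ... | inj₁ r′ = saturated-collapse saturated s≤j r′
    ... | inj₂ (w , rw , wx) = saturated x (reach-step s (saturated-collapse saturated s≤j rw) wx)

    reach⇒connected : ∀ k {u v} → T (R k u v) → T (connected n I u v)
    reach⇒connected k {u} {v} r with chain-stabilises (allFin n) (λ j → R j u) (λ j _ → reach-suc j)
    ... | s , s≤length , saturated = reach-mono (≤⇒≤′ s≤n) reach-s
      where
      s≤n : s ≤ n
      s≤n = subst (s ≤_) (length-tabulate id) s≤length
      reach-s : T (R s u v)
      reach-s with ≤-total k s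
      ... | inj₁ k≤s = reach-mono (≤⇒≤′ k≤s) r
      ... | inj₂ s≤k = saturated-collapse (λ x → saturated x (∈-allFin x)) (≤⇒≤′ s≤k) r

    connected-refl : ∀ u → T (connected n I u u)
    connected-refl u = reach⇒connected 0 (==-refl u)

    connected-step : ∀ {u x y} → T (connected n I u x) → T (adj I x y) → T (connected n I u y)
    connected-step ux xy = reach⇒connected (suc n) (reach-step n ux xy)

    connected-trans : ∀ {u w x} → T (connected n I u w) → T (connected n I w x) → T (connected n I u x)
    connected-trans {u} {w} uw = extend n
      where
      extend : ∀ k {x} → T (R k w x) → T (connected n I u x)
      extend zero wx rewrite ==⇒≡ wx = uw
      extend (suc k) wx with reach-inversion k wx
      ... | inj₁ wx′ = extend k wx′
      ... | inj₂ (z , wz , zx) = connected-step (extend k wz) zx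

    connected-sym : ∀ {u v} → T (connected n I u v) → T (connected n I v u)
    connected-sym {u} = reverse n
      where
      reverse : ∀ k {v} → T (R k u v) → T (connected n I v u)
      reverse zero uv rewrite ==⇒≡ uv = connected-refl _
      reverse (suc k) {v} uv with reach-inversion k uv
      ... | inj₁ uv′ = reverse k uv′
      ... | inj₂ (w , uw , wv) = connected-trans
            (connected-step (connected-refl v) (subst T (adj-sym w v) wv)) (reverse k uw)

    connected-inV : ∀ {u x} → T (inV I u) → T (connected n I u x) → T (inV I x)
    connected-inV {u} u∈V = go n
      where
      go : ∀ k {x} → T (R k u x) → T (inV I x)
      go zero ux rewrite ==⇒≡ ux = u∈V
      go (suc k) ux with reach-inversion k ux
      ... | inj₁ ux′ = go k ux′
      ... | inj₂ (_ , _ , wx) = adj⇒inV wx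

    isRep⇒inV : ∀ {v} → T (isRep n I v) → T (inV I v)
    isRep⇒inV {v} = proj₁ ∘ T-∧ {inV I v} .to

    isRep-minimal : ∀ {u v} → T (isRep n I v) → toℕ u < toℕ v → ¬ T (connected n I v u)
    isRep-minimal {u} {v} rep u<v
      with toℕ u <ᵇ toℕ v | <⇒<ᵇ u<v | connected n I v u
         | All-lookup (all⁺ _ (allFin n) (proj₂ (T-∧ {inV I v} .to rep))) (∈-allFin u)
    ... | true | _ | true | ()
    ... | true | _ | false | _ = λ ()

    isRep-unique : ∀ {v w x} → T (isRep n I v) → T (isRep n I w) →
      T (connected n I v x) → T (connected n I w x) → v ≡ w
    isRep-unique {v} {w} v-rep w-rep vx wx with <-cmp (toℕ v) (toℕ w)
    ... | tri< v<w _ _ = ⊥-elim (isRep-minimal w-rep v<w (connected-trans wx (connected-sym vx)))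
    ... | tri≈ _ v≡w _ = toℕ-injective v≡w
    ... | tri> _ _ w<v = ⊥-elim (isRep-minimal v-rep w<v (connected-trans vx (connected-sym wx)))

    reps-reaching≤ : ∀ x → ∑ (λ v → 𝟙 (isRep n I v ∧ connected n I v x)) (allFin n) ≤ 𝟙 (inV I x)
    reps-reaching≤ x = ∑-𝟙-allFin-atMostOne _
      (λ v w vx wx →
         isRep-unique (proj₁ (split vx)) (proj₁ (split wx)) (proj₂ (split vx)) (proj₂ (split wx)))
      (λ v vx → connected-inV (isRep⇒inV (proj₁ (split vx))) (proj₂ (split vx)))
      where
      split : ∀ {v} → T (isRep n I v ∧ connected n I v x) → T (isRep n I v) × T (connected n I v x)
      split {v} = T-∧ {isRep n I v} .to

  ends : ∀ {n} → (Fin n → Bool) → Edge n → ℕ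
  ends V (x , y) = 𝟙 (V x) + 𝟙 (V y)

  crossing : ∀ {n} → (Fin n → Bool) → Edge n → ℕ
  crossing P (x , y) = 𝟙 (P x xor P y)

  cutSize : ∀ {n} → List (Edge n) → (Fin n → Bool) → ℕ
  cutSize G P = ∑ (crossing P) G

  -- Degree-sum form of d-regularity: ∑_{e ∈ G} |e ∩ V| = d |V| for every vertex set V.
  Regular : ∀ {n} → ℕ → List (Edge n) → Set
  Regular {n} d G = ∀ V → ∑ (ends V) G ≡ d * countᵇ V (allFin n)

  -- Equivalent to k-edge-connectivity: every cut separating two vertices separates one of them
  -- from vertex zero.
  EdgeConnected : ∀ {n} → ℕ → List (Edge (suc n)) → Set
  EdgeConnected k G = ∀ P v → ¬ T (P zero) → T (P v) → k ≤ cutSize G P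

  cutSize-closed : ∀ {n} (I : List (Edge n)) P → (∀ {x y} → (x , y) ∈ I → P x ≡ P y) →
    cutSize I P ≡ 0
  cutSize-closed I P closed = ∑-≡0 I no-crossing
    where
    no-crossing : ∀ e → e ∈ I → crossing P e ≡ 0
    no-crossing (x , y) xy∈I = cong 𝟙 (trans (cong (P x xor_) (sym (closed xy∈I))) (xor-same (P x)))

  module _ {n : ℕ} (I : List (Edge n)) where

    ends-subgraph : ∑ (ends (inV I)) I ≡ 2 * length I
    ends-subgraph = trans (∑-cong I both-ends) (∑-const 2 I)
      where
      both-ends : ∀ e → e ∈ I → ends (inV I) e ≡ 2
      both-ends (x , y) xy∈I with edge⇒inV I xy∈I
      ... | x∈V , y∈V = cong₂ _+_ (𝟙-true x∈V) (𝟙-true y∈V)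

    components-closed : ∀ v {x y} → (x , y) ∈ I → connected n I v x ≡ connected n I v y
    components-closed v {x} {y} xy∈I = T-injective
      (λ vx → connected-step I vx (edge⇒adj I xy∈I))
      (λ vy → connected-step I vy (subst T (adj-sym I x y) (edge⇒adj I xy∈I)))

    reps-crossing≤ends : ∀ e →
      ∑ (λ v → 𝟙 (isRep n I v) * crossing (connected n I v) e) (allFin n) ≤ ends (inV I) e
    reps-crossing≤ends (x , y) = begin
      ∑ (λ v → 𝟙 (isRep n I v) * 𝟙 (connected n I v x xor connected n I v y)) (allFin n)
        ≤⟨ ∑-mono (allFin n) (λ v _ → crossing≤ (isRep n I v) (connected n I v x) (connected n I v y)) ⟩
      ∑ (λ v → 𝟙 (isRep n I v ∧ connected n I v x) + 𝟙 (isRep n I v ∧ connected n I v y)) (allFin n)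
        ≡⟨ ∑-+ _ _ (allFin n) ⟩
      ∑ (λ v → 𝟙 (isRep n I v ∧ connected n I v x)) (allFin n) +
      ∑ (λ v → 𝟙 (isRep n I v ∧ connected n I v y)) (allFin n)
        ≤⟨ +-mono-≤ (reps-reaching≤ I x) (reps-reaching≤ I y) ⟩
      𝟙 (inV I x) + 𝟙 (inV I y) ∎
      where
      open ≤-Reasoning
      crossing≤ : ∀ r a b → 𝟙 r * 𝟙 (a xor b) ≤ 𝟙 (r ∧ a) + 𝟙 (r ∧ b)
      crossing≤ false a b = z≤n
      crossing≤ true true true = z≤n
      crossing≤ true true false = ≤-refl
      crossing≤ true false true = ≤-refl
      crossing≤ true false false = z≤n

  module _ {n′ : ℕ} {G I : List (Edge (suc n′))} (I⊆G : I ⊆ G) where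

    private
      n : ℕ
      n = suc n′

      J : List (Edge n)
      J = complement I⊆G

      nonzero : List (Fin n)
      nonzero = tabulate suc

    component-cut : ∀ {k} → EdgeConnected k G → ∀ {v} → T (isRep n I v) → 0 < toℕ v →
      k ≤ cutSize J (connected n I v)
    component-cut {k} edgeConnected {v} v-rep 0<v = begin
      k                          ≤⟨ edgeConnected P v (isRep-minimal I v-rep 0<v) (connected-refl I v) ⟩
      cutSize G P                ≡⟨ ∑-complement (crossing P) I⊆G ⟩
      cutSize I P + cutSize J P  ≡⟨ cong (_+ cutSize J P) (cutSize-closed I P (components-closed I v)) ⟩
      cutSize J P                ∎
      where
      open ≤-Reasoning
      P : Fin n → Bool
      P = connected n I v

    numComp≤ : numComp n I ≤ 1 + ∑ (𝟙 ∘ isRep n I) nonzero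
    numComp≤ = subst (_≤ 1 + ∑ (𝟙 ∘ isRep n I) nonzero) (sym (countᵇ≡∑𝟙 (isRep n I) (allFin n)))
      (+-monoˡ-≤ _ (𝟙≤1 (isRep n I zero)))

    nonzero-reps-cut : ∀ {k} → EdgeConnected k G → k * ∑ (𝟙 ∘ isRep n I) nonzero ≤ ∑ (ends (inV I)) J
    nonzero-reps-cut {k} edgeConnected = begin
      k * ∑ (𝟙 ∘ isRep n I) nonzero                      ≡⟨ sym (∑-*ˡ k _ nonzero) ⟩
      ∑ (λ v → k * 𝟙 (isRep n I v)) nonzero               ≤⟨ ∑-mono nonzero rep-cut ⟩
      ∑ (λ v → 𝟙 (isRep n I v) * cut v) nonzero            ≤⟨ m≤n+m _ _ ⟩
      ∑ (λ v → 𝟙 (isRep n I v) * cut v) (allFin n)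
        ≡⟨ ∑-cong (allFin n) (λ v _ → sym (∑-*ˡ (𝟙 (isRep n I v)) (crossing (connected n I v)) J)) ⟩
      ∑ (λ v → ∑ (λ e → 𝟙 (isRep n I v) * crossing (connected n I v) e) J) (allFin n)
                                                          ≡⟨ ∑-comm _ (allFin n) J ⟩
      ∑ (λ e → ∑ (λ v → 𝟙 (isRep n I v) * crossing (connected n I v) e) (allFin n)) J
                                                          ≤⟨ ∑-mono J (λ e _ → reps-crossing≤ends I e) ⟩
      ∑ (ends (inV I)) J                                  ∎
      where
      open ≤-Reasoning
      cut : Fin n → ℕ
      cut v = cutSize J (connected n I v)
      rep-cut : ∀ v → v ∈ nonzero → k * 𝟙 (isRep n I v) ≤ 𝟙 (isRep n I v) * cut v
      rep-cut v v∈nonzero with T? (isRep n I v) | ∈-tabulate⁻ v∈nonzero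
      ... | yes v-rep | _ , refl rewrite 𝟙-true v-rep =
        subst₂ _≤_ (sym (*-identityʳ k)) (sym (+-identityʳ _)) (component-cut edgeConnected v-rep z<s)
      ... | no ¬v-rep | _ rewrite 𝟙-false ¬v-rep = ≤-reflexive (*-zeroʳ k)

    subgraph-bound : ∀ d k → Regular d G → EdgeConnected k G →
      2 * length I + k * numComp n I ≤ d * numV n I + k
    subgraph-bound d k regular edgeConnected = begin
      2 * length I + k * numComp n I             ≤⟨ +-monoʳ-≤ (2 * length I) (*-monoʳ-≤ k numComp≤) ⟩
      2 * length I + k * (1 + c₊)                ≡⟨ cong (2 * length I +_) (trans (*-suc k c₊) (+-comm k _)) ⟩
      2 * length I + (k * c₊ + k)                ≡⟨ sym (+-assoc (2 * length I) _ k) ⟩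
      2 * length I + k * c₊ + k                  ≤⟨ +-monoˡ-≤ k (+-mono-≤ (≤-reflexive (sym (ends-subgraph I)))
                                                                            (nonzero-reps-cut edgeConnected)) ⟩
      ∑ (ends V) I + ∑ (ends V) J + k            ≡⟨ cong (_+ k) (sym (∑-complement (ends V) I⊆G)) ⟩
      ∑ (ends V) G + k                           ≡⟨ cong (_+ k) (regular V) ⟩
      d * numV n I + k                           ∎
      where
      open ≤-Reasoning
      V : Fin n → Bool
      V = inV I
      c₊ : ℕ
      c₊ = ∑ (𝟙 ∘ isRep n I) nonzero

  changes : ℕ → (ℕ → Bool) → ℕ
  changes m X = ∑< m (λ i → 𝟙 (X i xor X (suc i)))

  mismatches : ℕ → (ℕ → Bool) → (ℕ → Bool) → ℕ
  mismatches m X Y = ∑< m (λ i → 𝟙 (X i xor Y i))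

  Constant : ℕ → (ℕ → Bool) → Set
  Constant m X = ∀ i → i < m → X i ≡ X 0

  𝟙-xor-≢ : ∀ {p q} → p ≢ q → 𝟙 (p xor q) ≡ 1
  𝟙-xor-≢ {false} {false} p≢q = ⊥-elim (p≢q refl)
  𝟙-xor-≢ {false} {true} _ = refl
  𝟙-xor-≢ {true} {false} _ = refl
  𝟙-xor-≢ {true} {true} p≢q = ⊥-elim (p≢q refl)

  𝟙-xor-triangle : ∀ p q r → 𝟙 (p xor r) ≤ 𝟙 (p xor q) + 𝟙 (q xor r)
  𝟙-xor-triangle false false r = ≤-refl
  𝟙-xor-triangle false true false = z≤n
  𝟙-xor-triangle false true true = s≤s z≤n
  𝟙-xor-triangle true false false = s≤s z≤n
  𝟙-xor-triangle true false true = z≤n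
  𝟙-xor-triangle true true r = ≤-refl

  changes-≥-endpoints : ∀ m (X : ℕ → Bool) → 𝟙 (X 0 xor X m) ≤ changes m X
  changes-≥-endpoints zero X = ≤-reflexive (cong 𝟙 (xor-same (X 0)))
  changes-≥-endpoints (suc m) X = begin
    𝟙 (X 0 xor X (suc m))                     ≤⟨ 𝟙-xor-triangle (X 0) (X m) (X (suc m)) ⟩
    𝟙 (X 0 xor X m) + 𝟙 (X m xor X (suc m))   ≤⟨ +-monoˡ-≤ _ (changes-≥-endpoints m X) ⟩
    changes m X + 𝟙 (X m xor X (suc m))       ≡⟨ sym (∑<-snoc m _) ⟩
    changes (suc m) X                         ∎
    where open ≤-Reasoning

  changes-split : ∀ j k (X : ℕ → Bool) → changes (j + k) X ≡ changes j X + changes k (λ i → X (j + i))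
  changes-split j k X = trans (∑<-split j k _)
    (cong (changes j X +_) (∑<-cong k λ i _ → cong (λ l → 𝟙 (X (j + i) xor X l)) (sym (+-suc j i))))

  changes-cycle : ∀ m (X : ℕ → Bool) {j} → X m ≡ X 0 → j ≤ m → X j ≢ X 0 → 2 ≤ changes m X
  changes-cycle m X {j} Xm≡X0 j≤m Xj≢X0 with m≤n⇒∃[o]m+o≡n j≤m
  ... | k , refl = begin
    1 + 1
      ≡⟨ cong₂ _+_ (sym (𝟙-xor-≢ (Xj≢X0 ∘ sym))) (sym (𝟙-xor-≢ Xj≢Xm)) ⟩
    𝟙 (X 0 xor X j) + 𝟙 (X j xor X (j + k))       ≤⟨ +-mono-≤ (changes-≥-endpoints j X) from-j ⟩
    changes j X + changes k (λ i → X (j + i))     ≡⟨ sym (changes-split j k X) ⟩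
    changes (j + k) X                             ∎
    where
    open ≤-Reasoning
    Xj≢Xm : X j ≢ X (j + k)
    Xj≢Xm Xj≡Xm = Xj≢X0 (trans Xj≡Xm Xm≡X0)
    from-j : 𝟙 (X j xor X (j + k)) ≤ changes k (λ i → X (j + i))
    from-j = subst (λ l → 𝟙 (X l xor X (j + k)) ≤ changes k (λ i → X (j + i))) (+-identityʳ j)
      (changes-≥-endpoints k (λ i → X (j + i)))

  constant-or-not : ∀ m (X : ℕ → Bool) b → (∀ i → i < m → X i ≡ b) ⊎ ∃[ j ] (j < m × X j ≢ b)
  constant-or-not zero X b = inj₁ λ _ ()
  constant-or-not (suc m) X b with X 0 ≟ᵇ b | constant-or-not m (X ∘ suc) b
  ... | no X0≢b | _ = inj₂ (0 , z<s , X0≢b)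
  ... | yes _ | inj₂ (j , j<m , Xj≢b) = inj₂ (suc j , s<s j<m , Xj≢b)
  ... | yes X0≡b | inj₁ constant = inj₁ λ { zero _ → X0≡b ; (suc i) (s<s i<m) → constant i i<m }

  mismatches-comm : ∀ m (X Y : ℕ → Bool) → mismatches m X Y ≡ mismatches m Y X
  mismatches-comm m X Y = ∑<-cong m λ i _ → cong 𝟙 (xor-comm (X i) (Y i))

  mismatches-constant : ∀ m (X Y : ℕ → Bool) {j} → Constant m X → j < m → Y j ≢ Y 0 →
    1 ≤ mismatches m X Y
  mismatches-constant m X Y {j} constant j<m Yj≢Y0 with X 0 ≟ᵇ Y 0
  ... | no X0≢Y0 = subst (_≤ mismatches m X Y) (𝟙-xor-≢ X0≢Y0) (∑<-term m _ (≤-trans (s≤s z≤n) j<m))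
  ... | yes X0≡Y0 = subst (_≤ mismatches m X Y) (𝟙-xor-≢ Xj≢Yj) (∑<-term m _ j<m)
    where
    Xj≢Yj : X j ≢ Y j
    Xj≢Yj Xj≡Yj = Yj≢Y0 (trans (sym Xj≡Yj) (trans (constant j j<m) X0≡Y0))

  mismatches-constants : ∀ m (X Y : ℕ → Bool) → Constant m X → Constant m Y →
    X 0 ≢ Y 0 → mismatches m X Y ≡ m
  mismatches-constants m X Y X-constant Y-constant X0≢Y0 = trans
    (∑<-cong m λ i i<m → 𝟙-xor-≢ λ Xi≡Yi →
       X0≢Y0 (trans (sym (X-constant i i<m)) (trans Xi≡Yi (Y-constant i i<m))))
    (∑<-ones m)
    where
    ∑<-ones : ∀ m → ∑< m (λ _ → 1) ≡ m
    ∑<-ones zero = refl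
    ∑<-ones (suc m) = cong suc (∑<-ones m)

  two-cycles-cut : ∀ m (X Y : ℕ → Bool) → 3 ≤ m → X m ≡ X 0 → Y m ≡ Y 0 → ¬ T (X 0) →
    ∃[ i ] (i < m × (T (X i) ⊎ T (Y i))) → 3 ≤ mismatches m X Y + changes m X + changes m Y
  two-cycles-cut m X Y 3≤m X-periodic Y-periodic ¬X0 witness =
    bound (constant-or-not m X (X 0)) (constant-or-not m Y (Y 0))
    where
    X-cycle : ∀ {j} → j < m → X j ≢ X 0 → 2 ≤ changes m X
    X-cycle j<m = changes-cycle m X X-periodic (<⇒≤ j<m)

    Y-cycle : ∀ {j} → j < m → Y j ≢ Y 0 → 2 ≤ changes m Y
    Y-cycle j<m = changes-cycle m Y Y-periodic (<⇒≤ j<m)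

    bound : Constant m X ⊎ ∃[ j ] (j < m × X j ≢ X 0) →
            Constant m Y ⊎ ∃[ j ] (j < m × Y j ≢ Y 0) →
            3 ≤ mismatches m X Y + changes m X + changes m Y
    bound (inj₂ (j , j<m , Xj≢X0)) (inj₂ (k , k<m , Yk≢Y0)) =
      ≤-trans (n≤1+n 3) (+-mono-≤ (+-mono-≤ z≤n (X-cycle j<m Xj≢X0)) (Y-cycle k<m Yk≢Y0))
    bound (inj₁ X-constant) (inj₂ (k , k<m , Yk≢Y0)) =
      +-mono-≤ (+-mono-≤ (mismatches-constant m X Y X-constant k<m Yk≢Y0) z≤n) (Y-cycle k<m Yk≢Y0)
    bound (inj₂ (j , j<m , Xj≢X0)) (inj₁ Y-constant) =
      +-mono-≤ (+-mono-≤ (subst (1 ≤_) (mismatches-comm m Y X)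
                                (mismatches-constant m Y X Y-constant j<m Xj≢X0))
                         (X-cycle j<m Xj≢X0)) z≤n
    bound (inj₁ X-constant) (inj₁ Y-constant) = all-rungs witness
      where
      all-rungs : ∃[ i ] (i < m × (T (X i) ⊎ T (Y i))) → 3 ≤ mismatches m X Y + changes m X + changes m Y
      all-rungs (i , i<m , inj₁ Xi) = ⊥-elim (¬X0 (subst T (X-constant i i<m) Xi))
      all-rungs (i , i<m , inj₂ Yi) = begin
        3                                            ≤⟨ 3≤m ⟩
        m
          ≡⟨ sym (mismatches-constants m X Y X-constant Y-constant X0≢Y0) ⟩
        mismatches m X Y                             ≤⟨ m≤m+n _ _ ⟩
        mismatches m X Y + changes m X               ≤⟨ m≤m+n _ _ ⟩
        mismatches m X Y + changes m X + changes m Y ∎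
        where
        open ≤-Reasoning
        X0≢Y0 : X 0 ≢ Y 0
        X0≢Y0 X0≡Y0 = ¬X0 (subst T (sym X0≡Y0) (subst T (Y-constant i i<m) Yi))

  module Prism (n′ : ℕ) (6≤n : 6 ≤ suc n′) (even : 2 ∣ suc n′) where

    private
      n : ℕ
      n = suc n′

    m : ℕ
    m = n / 2

    2m≡n : 2 * m ≡ n
    2m≡n = m*[n/m]≡n even

    3≤m : 3 ≤ m
    3≤m = *-cancelˡ-≤ 2 (subst (6 ≤_) (sym 2m≡n) 6≤n)

    -- a i = v_{2i+1} and b i = v_{2i+2} run along the two cycles, indices modulo m.
    a b : ℕ → Fin n
    a i = vtx n (2 * i)
    b i = vtx n (2 * i + 1)

    vtx-periodic : ∀ k → vtx n (k + n) ≡ vtx n k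
    vtx-periodic k = toℕ-injective (trans (toℕ-fromℕ< _) (trans ([m+n]%n≡m%n k n) (sym (toℕ-fromℕ< _))))

    a-periodic : a m ≡ a 0
    a-periodic = trans (cong (vtx n) 2m≡n) (vtx-periodic 0)

    b-periodic : b m ≡ b 0
    b-periodic = trans (cong (vtx n) (trans (cong (_+ 1) 2m≡n) (+-comm n 1))) (vtx-periodic 1)

    ∑-vertices : ∀ (q : Fin n → ℕ) → ∑ q (allFin n) ≡ ∑< m (λ i → q (a i) + q (b i))
    ∑-vertices q = begin
      ∑ q (allFin n)                        ≡⟨ ∑-tabulate q id (vtx n) vtx-toℕ ⟩
      ∑< n (q ∘ vtx n)                      ≡⟨ cong (λ k → ∑< k (q ∘ vtx n)) (sym 2m≡n) ⟩
      ∑< (2 * m) (q ∘ vtx n)                ≡⟨ ∑<-pairs m (q ∘ vtx n) ⟩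
      ∑< m (λ i → q (a i) + q (b i))        ∎
      where
      open ≡-Reasoning
      vtx-toℕ : ∀ v → v ≡ vtx n (toℕ v)
      vtx-toℕ v = toℕ-injective (sym (trans (toℕ-fromℕ< _) (m<n⇒m%n≡m (toℕ<n v))))

    ∑-edges : ∀ (w : Edge n → ℕ) →
      ∑ w (CE n) ≡ ∑< m (λ i → w (a i , b i) + w (a i , a (suc i)) + w (b i , b (suc i)))
    ∑-edges w = trans (∑-concatMap-applyUpTo w _ id m) (∑<-cong m λ i _ → block i)
      where
      2i+2≡2[1+i] : ∀ i → 2 * i + 2 ≡ 2 * suc i
      2i+2≡2[1+i] = solve-∀
      2i+3≡2[1+i]+1 : ∀ i → 2 * i + 3 ≡ 2 * suc i + 1
      2i+3≡2[1+i]+1 = solve-∀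
      block : ∀ i →
        w (a i , vtx n (2 * i + 1)) + (w (a i , vtx n (2 * i + 2)) + (w (b i , vtx n (2 * i + 3)) + 0))
          ≡ w (a i , b i) + w (a i , a (suc i)) + w (b i , b (suc i))
      block i rewrite +-identityʳ (w (b i , vtx n (2 * i + 3)))
                    | cong (vtx n) (2i+2≡2[1+i] i) | cong (vtx n) (2i+3≡2[1+i]+1 i) =
        sym (+-assoc (w (a i , b i)) (w (a i , a (suc i))) (w (b i , b (suc i))))

    regular : Regular 3 (CE n)
    regular V = begin
      ∑ (ends V) (CE n)
        ≡⟨ ∑-edges (ends V) ⟩
      ∑< m (λ i → g i + (𝟙 (V (a i)) + 𝟙 (V (a (suc i)))) + (𝟙 (V (b i)) + 𝟙 (V (b (suc i)))))
        ≡⟨ ∑<-cong m (λ i _ →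
             regroup (𝟙 (V (a i))) (𝟙 (V (b i))) (𝟙 (V (a (suc i)))) (𝟙 (V (b (suc i))))) ⟩
      ∑< m (λ i → g i + g i + g (suc i))
        ≡⟨ trans (∑<-+ m _ _) (cong₂ _+_ (∑<-+ m g g) (∑<-rotate m g g-periodic)) ⟩
      ∑< m g + ∑< m g + ∑< m g
        ≡⟨ thrice (∑< m g) ⟩
      3 * ∑< m g
        ≡⟨ cong (3 *_) (sym (trans (countᵇ≡∑𝟙 V (allFin n)) (∑-vertices (𝟙 ∘ V)))) ⟩
      3 * countᵇ V (allFin n) ∎
      where
      open ≡-Reasoning
      g : ℕ → ℕ
      g i = 𝟙 (V (a i)) + 𝟙 (V (b i))
      g-periodic : g m ≡ g 0
      g-periodic = cong₂ _+_ (cong (𝟙 ∘ V) a-periodic) (cong (𝟙 ∘ V) b-periodic)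
      regroup : ∀ p q r s → p + q + (p + r) + (q + s) ≡ p + q + (p + q) + (r + s)
      regroup = solve-∀
      thrice : ∀ x → x + x + x ≡ 3 * x
      thrice = solve-∀

    edgeConnected : EdgeConnected 3 (CE n)
    edgeConnected P v ¬P0 Pv = subst (3 ≤_) (sym cut≡)
      (two-cycles-cut m (P ∘ a) (P ∘ b) 3≤m (cong P a-periodic) (cong P b-periodic) ¬P0 witness)
      where
      cut≡ : cutSize (CE n) P ≡ mismatches m (P ∘ a) (P ∘ b) + changes m (P ∘ a) + changes m (P ∘ b)
      cut≡ = trans (∑-edges (crossing P)) (trans (∑<-+ m _ _) (cong (_+ changes m (P ∘ b)) (∑<-+ m _ _)))

      witness : ∃[ i ] (i < m × (T (P (a i)) ⊎ T (P (b i))))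
      witness with ∑<-positive m _ (subst (0 <_) (∑-vertices (𝟙 ∘ P))
                     (subst (_≤ ∑ (𝟙 ∘ P) (allFin n)) (𝟙-true Pv)
                            (∑-member (𝟙 ∘ P) (∈-allFin v))))
      ... | i , i<m , positive = i , i<m , one-of (P (a i)) (P (b i)) positive
        where
        one-of : ∀ p q → 0 < 𝟙 p + 𝟙 q → T p ⊎ T q
        one-of true _ _ = inj₁ _
        one-of false true _ = inj₂ _

open import Defs
open import Data.Nat as ℕ using (ℕ; suc; _≤_; NonZero)
open import Data.Nat.Divisibility using (_∣_)
open import Data.List using (List; length)
open import Data.List.Relation.Binary.Sublist.Propositional using (_⊆_)
open import Data.Integer using (ℤ; +_; _+_; -_; _-_; _*_; +≤+) renaming (_≤_ to _≤ℤ_)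
open import Data.Integer.Properties using (pos-*; +-monoˡ-≤; module ≤-Reasoning)
open import Data.Integer.Tactic.RingSolver using (solve-∀)
open import Relation.Binary.PropositionalEquality using (_≡_; cong; cong₂; sym)
open CutCounting using (subgraph-bound; module Prism)

ℕ-bound⇒ℤ : ∀ l c v → 2 ℕ.* l ℕ.+ 3 ℕ.* c ≤ 3 ℕ.* v ℕ.+ 3 →
  (+ 2) * (+ l) - + 3 ≤ℤ (+ 3) * (+ v - + c)
ℕ-bound⇒ℤ l c v le = begin
  L - + 3                              ≡⟨ shift L C (+ 3) ⟩
  (L + C) - (C + + 3)                  ≡⟨ cong (_- (C + + 3)) (sym (cong₂ _+_ (pos-* 2 l) (pos-* 3 c))) ⟩
  + (2 ℕ.* l ℕ.+ 3 ℕ.* c) - (C + + 3)   ≤⟨ +-monoˡ-≤ (- (C + + 3)) (+≤+ le) ⟩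
  + (3 ℕ.* v ℕ.+ 3) - (C + + 3)         ≡⟨ cong (λ t → t + + 3 - (C + + 3)) (pos-* 3 v) ⟩
  (+ 3) * (+ v) + + 3 - (C + + 3)      ≡⟨ unshift (+ v) (+ c) ⟩
  (+ 3) * (+ v - + c)                  ∎
  where
  open ≤-Reasoning
  L C : ℤ
  L = (+ 2) * (+ l)
  C = (+ 3) * (+ c)
  shift : ∀ x y z → x - z ≡ (x + y) - (y + z)
  shift = solve-∀
  unshift : ∀ x y → (+ 3) * x + + 3 - ((+ 3) * y + + 3) ≡ (+ 3) * (x - y)
  unshift = solve-∀

lemma3p2 : (n : ℕ) .{{_ : NonZero n}} → 6 ≤ n → 2 ∣ n →
    (I : List (Edge n)) → I ⊆ CE n →
    (+ 2) * (+ length I) - + 3 ≤ℤ (+ 3) * (+ numV n I - + numComp n I)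
lemma3p2 (suc n′) 6≤n even I I⊆CE =
  ℕ-bound⇒ℤ (length I) (numComp (suc n′) I) (numV (suc n′) I)
    (subgraph-bound I⊆CE 3 3 (Prism.regular n′ 6≤n even) (Prism.edgeConnected n′ 6≤n even))
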